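{- For every $n\ge 1$, every $\pi\in\mathcal{S}_n$, and every $\mathcal{L}=(L_1,\dots,L_n)$ with $L_i\subseteq[n]$, \[\mathrm{SP}(n,\mathcal{L},\pi)=\prod_{i=1}^n\left(\sum_{\ell\in L_i}\binom{n-\mathrm{inv}_i(\pi)-1}{\ell-1}\right).\]
   Context: Let $[n]=\{1,\dots,n\}$, $\mathcal{S}_n$ the permutations of $[n]$ in one-line notation, and $\pi_i^{ -1}$ the position $j$ with $\pi_j=i$. A tuple $(C_1,\dots,C_n)$ of non-empty subsets of $[n]$ is a subset parking function with outcome $\pi$ if for every $1\le i\le n$, $\pi_i^{ -1}$ is the smallest element of $C_i\setminus\{\pi_{i'}^{ -1}:i'<i\}$; it is an $\mathcal{L}$-parking function if also $|C_i|\in L_i$ for all $i$. $\mathrm{SP}(n,\mathcal{L},\pi)$ is the number of $\mathcal{L}$-parking functions with outcome $\pi$. For a value $1\le i\le n$, $\mathrm{inv}_i(\pi)$ is the number of positions $q<\pi_i^{ -1}$ with $\pi_q>i$. Binomial conventions: $\binom{0}{0}=1$, $\binom{a}{b}=0$ for $b>a\ge 0$. -}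

module Defs where

open import Data.Nat.Base using (ℕ; zero; suc; _∸_)
open import Data.Nat.Combinatorics renaming (_C_ to binom)
open import Data.Fin.Base using (Fin; toℕ; _<_; _≤_)
open import Data.Fin.Properties using (_<?_; _≤?_; _≟_; any?; all?)
open import Data.Fin.Subset using (Subset; _∈_; ∣_∣; Nonempty)
open import Data.Fin.Subset.Properties using (_∈?_)
open import Data.Fin.Permutation using (Permutation′; _⟨$⟩ʳ_; _⟨$⟩ˡ_)
open import Data.Vec.Base as Vec using (Vec; []; _∷_; lookup; count; allFin)
open import Data.List.Base using (List; []; _∷_; [_]; map; _++_; concatMap; filter; length)
open import Data.Nat.ListAction using (sum; product)
open import Data.Bool.Base using (true; false; if_then_else_)
open import Data.Product.Base using (_×_; ∃; _,_)
open import Relation.Nullary using (¬_; Dec; does)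
open import Relation.Nullary.Decidable using (_×-dec_; _→-dec_; ¬?)

-- Positions and values in [n] are represented by Fin n (value k ↔ toℕ k + 1);
-- the order on Fin n is the order on [n].
-- A permutation π ∈ S_n in one-line notation: π_j = π ⟨$⟩ʳ j,
-- and π⁻¹_i = π ⟨$⟩ˡ i (the position j with π_j = i).

Removed : {n : ℕ} → Permutation′ n → Fin n → Fin n → Set
Removed π i q = ∃ λ i' → (i' < i) × (π ⟨$⟩ˡ i' ≡' q)
  where open import Relation.Binary.PropositionalEquality using () renaming (_≡_ to _≡'_)

InDiff : {n : ℕ} → Permutation′ n → Fin n → Subset n → Fin n → Set
InDiff π i C q = (q ∈ C) × ¬ Removed π i q

IsSmallest : {n : ℕ} → Permutation′ n → Fin n → Subset n → Fin n → Set
IsSmallest π i C p = InDiff π i C p × (∀ q → InDiff π i C q → p ≤ q)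

IsSPF : {n : ℕ} → Permutation′ n → (Fin n → Subset n) → Set
IsSPF π C = (∀ i → Nonempty (C i)) × (∀ i → IsSmallest π i (C i) (π ⟨$⟩ˡ i))

-- 𝓛 = (L_1,…,L_n), L_i ⊆ [n], encoded as L i : Subset n where the element
-- k : Fin n stands for the size ℓ = toℕ k + 1.
SizeIn : {n : ℕ} → Subset n → ℕ → Set
SizeIn {n} Li ℓ = ∃ λ (k : Fin n) → (k ∈ Li) × (suc (toℕ k) ≡' ℓ)
  where open import Relation.Binary.PropositionalEquality using () renaming (_≡_ to _≡'_)

IsLPF : {n : ℕ} → (Fin n → Subset n) → Permutation′ n → (Fin n → Subset n) → Set
IsLPF L π C = IsSPF π C × (∀ i → SizeIn (L i) ∣ C i ∣)

open import Relation.Binary.PropositionalEquality using (_≡_)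
import Data.Nat.Properties as ℕP

removed? : {n : ℕ} (π : Permutation′ n) (i q : Fin n) → Dec (Removed π i q)
removed? π i q = any? (λ i' → (i' <? i) ×-dec (π ⟨$⟩ˡ i' ≟ q))

inDiff? : {n : ℕ} (π : Permutation′ n) (i : Fin n) (C : Subset n) (q : Fin n) → Dec (InDiff π i C q)
inDiff? π i C q = (q ∈? C) ×-dec ¬? (removed? π i q)

isSmallest? : {n : ℕ} (π : Permutation′ n) (i : Fin n) (C : Subset n) (p : Fin n) → Dec (IsSmallest π i C p)
isSmallest? π i C p = inDiff? π i C p ×-dec all? (λ q → inDiff? π i C q →-dec (p ≤? q))

isSPF? : {n : ℕ} (π : Permutation′ n) (C : Fin n → Subset n) → Dec (IsSPF π C)
isSPF? π C = all? (λ i → any? (λ f → f ∈? C i)) ×-dec all? (λ i → isSmallest? π i (C i) (π ⟨$⟩ˡ i))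

sizeIn? : {n : ℕ} (Li : Subset n) (ℓ : ℕ) → Dec (SizeIn Li ℓ)
sizeIn? Li ℓ = any? (λ k → (k ∈? Li) ×-dec (suc (toℕ k) ℕP.≟ ℓ))

isLPF? : {n : ℕ} (L : Fin n → Subset n) (π : Permutation′ n) (C : Fin n → Subset n) → Dec (IsLPF L π C)
isLPF? L π C = isSPF? π C ×-dec all? (λ i → sizeIn? (L i) ∣ C i ∣)

allSubsets : (m : ℕ) → List (Subset m)
allSubsets zero = [ [] ]
allSubsets (suc m) = map (true ∷_) (allSubsets m) ++ map (false ∷_) (allSubsets m)

allTuples : {A : Set} → List A → (k : ℕ) → List (Vec A k)
allTuples xs zero = [ [] ]
allTuples xs (suc k) = concatMap (λ x → map (x ∷_) (allTuples xs k)) xs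

SP : (n : ℕ) → (Fin n → Subset n) → Permutation′ n → ℕ
SP n L π = length (filter (λ C → isLPF? L π (lookup C)) (allTuples (allSubsets n) n))

inv : {n : ℕ} → Permutation′ n → Fin n → ℕ
inv {n} π i = count (λ q → (q <? (π ⟨$⟩ˡ i)) ×-dec (i <? (π ⟨$⟩ʳ q))) (allFin n)

-- Σ_{ℓ ∈ L_i} binom(m, ℓ - 1), with ℓ = toℕ k + 1
sumOver : {n : ℕ} → Subset n → ℕ → ℕ
sumOver {n} Li m = sum (Data.List.Base.map (λ k → if does (k ∈? Li) then binom m (toℕ k) else 0) (Data.List.Base.allFin n))
  where import Data.List.Base

RHS : (n : ℕ) → (Fin n → Subset n) → Permutation′ n → ℕ
RHS n L π = product (map (λ i → sumOver (L i) (n ∸ inv π i ∸ 1)) (Data.List.Base.allFin n))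
  where import Data.List.Base

module Submission where

-- The conditions defining an 𝓛-parking function with outcome π constrain each
-- Cᵢ separately, so the count is a product over i of the number of admissible
-- choices for Cᵢ (product principle for tuples, `#-tuples`).  Fix i and put
-- p = π⁻¹ᵢ.  Then p is the least element of Cᵢ ∖ {π⁻¹_{i'} : i' < i} iff
--   p ∈ Cᵢ, and no q < p outside {π⁻¹_{i'} : i' < i} lies in Cᵢ,
-- while all other positions are unconstrained.  Such a membership pattern has
-- one required position, invᵢ(π) forbidden positions (q < p with π_q > i) and
-- hence n - invᵢ(π) - 1 free ones, so exactly binom(n - invᵢ(π) - 1, ℓ - 1)
-- admissible sets have size ℓ (`#fitting`).  Summing over the sizes ℓ ∈ Lᵢ,
-- which are mutually exclusive, gives the i-th factor (`#admissible`).

open import Defs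
open import Data.Nat.Base using (ℕ; zero; suc; _+_; _*_; _∸_; _≤_; z≤n; s≤s)
import Data.Nat.Properties as ℕP
import Data.Bool.Properties as BoolP
open import Data.Nat.Combinatorics using (nCk+nC[k+1]≡[n+1]C[k+1]) renaming (_C_ to binom)
open import Data.Fin.Base as Fin using (Fin; toℕ; _<_)
import Data.Fin.Properties as FinP
open import Data.Fin.Properties using (any?; all?; _<?_; _≟_)
open import Data.Fin.Subset using (Subset; _∈_; ∣_∣)
open import Data.Fin.Subset.Properties using (_∈?_; ∣p∣≤∣x∷p∣)
open import Data.Fin.Permutation using (Permutation′; _⟨$⟩ʳ_; _⟨$⟩ˡ_; inverseˡ; inverseʳ)
open import Data.Vec.Base as Vec using (Vec; []; _∷_; lookup; tabulate)
import Data.Vec.Properties as VecP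
import Data.Vec.Functional as Vector
open import Data.List.Base as List using (List; []; _∷_; map; _++_; concatMap; filter; length; foldr)
import Data.List.Properties as ListP
open import Data.Bool.Base using (Bool; true; false; if_then_else_)
open import Data.Product.Base using (_×_; ∃; _,_; proj₁; proj₂)
open import Data.Unit.Base using (⊤; tt)
open import Data.Empty using (⊥-elim)
open import Function.Base using (_∘_)
open import Function.Bundles using (_⇔_; mk⇔; Equivalence)
import Function.Properties.Equivalence as ⇔
open import Relation.Nullary using (¬_; Dec; yes; no; does)
open import Relation.Nullary.Decidable using (_×-dec_; _⊎-dec_; ¬?)
open import Relation.Unary using (Decidable)
open import Relation.Binary.PropositionalEquality
open import Algebra.Properties.CommutativeMonoid.Sum ℕP.+-0-commutativeMonoid
  using (sum-syntax; sum-cong-≗; sum-replicate-zero)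
open import Algebra.Properties.CommutativeMonoid.Sum ℕP.*-1-commutativeMonoid
  using () renaming (sum to ∏; sum-cong-≗ to ∏-cong)

open Equivalence using (to; from)
open ≡-Reasoning

ind : {P : Set} → Dec P → ℕ
ind d = if does d then 1 else 0

ind-cong : {P Q : Set} (p : Dec P) (q : Dec Q) → P ⇔ Q → ind p ≡ ind q
ind-cong (yes _) (yes _) _ = refl
ind-cong (no _) (no _) _ = refl
ind-cong (yes a) (no ¬b) e = ⊥-elim (¬b (to e a))
ind-cong (no ¬a) (yes b) e = ⊥-elim (¬a (from e b))

ind-* : {P : Set} (d : Dec P) (c : ℕ) → ind d * c ≡ (if does d then c else 0)
ind-* (yes _) c = ℕP.+-identityʳ c
ind-* (no _) c = refl

#⟨_⟩ : {A : Set} {P : A → Set} → Decidable P → List A → ℕ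
#⟨ P? ⟩ xs = length (filter P? xs)

module _ {A : Set} where

  #-cons : {P : A → Set} (P? : Decidable P) (x : A) (xs : List A) →
           #⟨ P? ⟩ (x ∷ xs) ≡ ind (P? x) + #⟨ P? ⟩ xs
  #-cons P? x xs with does (P? x)
  ... | true = refl
  ... | false = refl

  #-cong : {P Q : A → Set} (P? : Decidable P) (Q? : Decidable Q) →
           (∀ x → P x ⇔ Q x) → ∀ xs → #⟨ P? ⟩ xs ≡ #⟨ Q? ⟩ xs
  #-cong P? Q? P⇔Q [] = refl
  #-cong P? Q? P⇔Q (x ∷ xs) = begin
    #⟨ P? ⟩ (x ∷ xs)         ≡⟨ #-cons P? x xs ⟩
    ind (P? x) + #⟨ P? ⟩ xs  ≡⟨ cong₂ _+_ (ind-cong (P? x) (Q? x) (P⇔Q x)) (#-cong P? Q? P⇔Q xs) ⟩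
    ind (Q? x) + #⟨ Q? ⟩ xs  ≡⟨ sym (#-cons Q? x xs) ⟩
    #⟨ Q? ⟩ (x ∷ xs)         ∎

  #-none : {P : A → Set} (P? : Decidable P) → (∀ x → ¬ P x) → ∀ xs → #⟨ P? ⟩ xs ≡ 0
  #-none P? ¬P [] = refl
  #-none P? ¬P (x ∷ xs) with P? x
  ... | yes Px = ⊥-elim (¬P x Px)
  ... | no _ = #-none P? ¬P xs

  #-⊎ : {P Q : A → Set} (P? : Decidable P) (Q? : Decidable Q) → (∀ x → P x → ¬ Q x) →
        ∀ xs → #⟨ (λ x → P? x ⊎-dec Q? x) ⟩ xs ≡ #⟨ P? ⟩ xs + #⟨ Q? ⟩ xs
  #-⊎ P? Q? disjoint [] = refl
  #-⊎ P? Q? disjoint (x ∷ xs) with P? x | Q? x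
  ... | yes Px | yes Qx = ⊥-elim (disjoint x Px Qx)
  ... | yes _  | no _   = cong suc (#-⊎ P? Q? disjoint xs)
  ... | no _   | yes _  = trans (cong suc (#-⊎ P? Q? disjoint xs)) (sym (ℕP.+-suc _ _))
  ... | no _   | no _   = #-⊎ P? Q? disjoint xs

  #-const× : {B : Set} {P : A → Set} (B? : Dec B) (P? : Decidable P) →
             ∀ xs → #⟨ (λ x → B? ×-dec P? x) ⟩ xs ≡ ind B? * #⟨ P? ⟩ xs
  #-const× (yes b) P? xs =
    trans (#-cong _ P? (λ _ → mk⇔ proj₂ (b ,_)) xs) (sym (ℕP.+-identityʳ _))
  #-const× (no ¬b) P? xs = #-none _ (λ _ → ¬b ∘ proj₁) xs

  #-++ : {P : A → Set} (P? : Decidable P) (xs ys : List A) →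
         #⟨ P? ⟩ (xs ++ ys) ≡ #⟨ P? ⟩ xs + #⟨ P? ⟩ ys
  #-++ P? xs ys = trans (cong length (ListP.filter-++ P? xs ys)) (ListP.length-++ (filter P? xs))

  #-map : {B : Set} {P : B → Set} (P? : Decidable P) (f : A → B) (xs : List A) →
          #⟨ P? ⟩ (map f xs) ≡ #⟨ P? ∘ f ⟩ xs
  #-map P? f [] = refl
  #-map P? f (x ∷ xs) with does (P? (f x))
  ... | true = cong suc (#-map P? f xs)
  ... | false = #-map P? f xs

module _ {A B : Set} where

  #-pairs : {C : Set} {P : A → Set} {R : B → Set} {S : C → Set}
            (P? : Decidable P) (R? : Decidable R) (S? : Decidable S) (f : A → B → C) →
            (∀ x y → S (f x y) ⇔ (P x × R y)) → ∀ xs ys →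
            #⟨ S? ⟩ (concatMap (λ x → map (f x) ys) xs) ≡ #⟨ P? ⟩ xs * #⟨ R? ⟩ ys
  #-pairs P? R? S? f S⇔ [] ys = refl
  #-pairs P? R? S? f S⇔ (x ∷ xs) ys = begin
    #⟨ S? ⟩ (map (f x) ys ++ rest)                  ≡⟨ #-++ S? (map (f x) ys) rest ⟩
    #⟨ S? ⟩ (map (f x) ys) + #⟨ S? ⟩ rest           ≡⟨ cong₂ _+_ row (#-pairs P? R? S? f S⇔ xs ys) ⟩
    ind (P? x) * #⟨ R? ⟩ ys + #⟨ P? ⟩ xs * #⟨ R? ⟩ ys ≡⟨ sym (ℕP.*-distribʳ-+ (#⟨ R? ⟩ ys) (ind (P? x)) _) ⟩
    (ind (P? x) + #⟨ P? ⟩ xs) * #⟨ R? ⟩ ys          ≡⟨ cong (_* #⟨ R? ⟩ ys) (sym (#-cons P? x xs)) ⟩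
    #⟨ P? ⟩ (x ∷ xs) * #⟨ R? ⟩ ys                   ∎
    where
    rest = concatMap (λ x → map (f x) ys) xs
    row : #⟨ S? ⟩ (map (f x) ys) ≡ ind (P? x) * #⟨ R? ⟩ ys
    row = begin
      #⟨ S? ⟩ (map (f x) ys)                   ≡⟨ #-map S? (f x) ys ⟩
      #⟨ S? ∘ f x ⟩ ys                         ≡⟨ #-cong _ _ (S⇔ x) ys ⟩
      #⟨ (λ y → P? x ×-dec R? y) ⟩ ys          ≡⟨ #-const× (P? x) R? ys ⟩
      ind (P? x) * #⟨ R? ⟩ ys                  ∎

#-∃ : {A : Set} {n : ℕ} {Q : Fin n → A → Set}
      (Q? : ∀ k → Decidable (Q k)) (∃Q? : Decidable (λ x → ∃ λ k → Q k x)) →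
      (∀ x {k l} → Q k x → Q l x → k ≡ l) →
      ∀ xs → #⟨ ∃Q? ⟩ xs ≡ ∑[ k < n ] #⟨ Q? k ⟩ xs
#-∃ {n = zero} Q? ∃Q? unique xs = #-none ∃Q? (λ { _ (() , _) }) xs
#-∃ {n = suc n} {Q} Q? ∃Q? unique xs = begin
  #⟨ ∃Q? ⟩ xs
    ≡⟨ #-cong ∃Q? (λ x → Q? Fin.zero x ⊎-dec ∃Q₊? x) (λ _ → ⇔.sym FinP.⊎⇔∃) xs ⟩
  #⟨ (λ x → Q? Fin.zero x ⊎-dec ∃Q₊? x) ⟩ xs
    ≡⟨ #-⊎ (Q? Fin.zero) ∃Q₊? (λ x Q₀ (_ , Q₊) → FinP.0≢1+n (unique x Q₀ Q₊)) xs ⟩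
  #⟨ Q? Fin.zero ⟩ xs + #⟨ ∃Q₊? ⟩ xs
    ≡⟨ cong (#⟨ Q? Fin.zero ⟩ xs +_)
         (#-∃ (Q? ∘ Fin.suc) ∃Q₊? (λ x Qk Ql → FinP.suc-injective (unique x Qk Ql)) xs) ⟩
  ∑[ k < suc n ] #⟨ Q? k ⟩ xs ∎
  where
  ∃Q₊? : Decidable (λ x → ∃ λ k → Q (Fin.suc k) x)
  ∃Q₊? x = any? (λ k → Q? (Fin.suc k) x)

count-tabulate : {A : Set} {n : ℕ} {P : A → Set} (P? : Decidable P) (f : Fin n → A) →
                 Vec.count P? (tabulate f) ≡ ∑[ k < n ] ind (P? (f k))
count-tabulate {n = zero} P? f = refl
count-tabulate {n = suc n} P? f with does (P? (f Fin.zero))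
... | true = cong suc (count-tabulate P? (f ∘ Fin.suc))
... | false = count-tabulate P? (f ∘ Fin.suc)

one-hot : {n : ℕ} (p : Fin n) → ∑[ k < n ] ind (k ≟ p) ≡ 1
one-hot {suc n} Fin.zero = cong suc (sum-replicate-zero n)
one-hot (Fin.suc p) = one-hot p

foldr-allFin : {n : ℕ} (_∙_ : ℕ → ℕ → ℕ) (e : ℕ) (f : Fin n → ℕ) →
               foldr _∙_ e (map f (List.allFin n)) ≡ Vector.foldr _∙_ e f
foldr-allFin _∙_ e f =
  trans (cong (foldr _∙_ e) (ListP.map-tabulate (λ k → k) f)) (foldr-tabulate f)
  where
  foldr-tabulate : {m : ℕ} (g : Fin m → ℕ) → foldr _∙_ e (List.tabulate g) ≡ Vector.foldr _∙_ e g
  foldr-tabulate {zero} g = refl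
  foldr-tabulate {suc m} g = cong (g Fin.zero ∙_) (foldr-tabulate (g ∘ Fin.suc))

#-tuples : {A : Set} {k : ℕ} {Q : Fin k → A → Set} (Q? : ∀ i → Decidable (Q i)) (xs : List A) →
           #⟨ (λ C → all? (λ i → Q? i (lookup C i))) ⟩ (allTuples xs k) ≡ ∏ (λ i → #⟨ Q? i ⟩ xs)
#-tuples {k = zero} Q? xs = refl
#-tuples {k = suc k} Q? xs = trans
  (#-pairs (Q? Fin.zero) (λ C → all? (λ i → Q? (Fin.suc i) (lookup C i))) _ _∷_
           (λ x C → ⇔.sym FinP.∀-cons-⇔) xs (allTuples xs k))
  (cong (#⟨ Q? Fin.zero ⟩ xs *_) (#-tuples (Q? ∘ Fin.suc) xs))

-- A membership pattern prescribes, for each position, whether a subset must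
-- contain it, must avoid it, or is free there.
data Status : Set where
  required forbidden free : Status

_≟ₛ_ : (s t : Status) → Dec (s ≡ t)
required  ≟ₛ required  = yes refl
required  ≟ₛ forbidden = no λ ()
required  ≟ₛ free      = no λ ()
forbidden ≟ₛ required  = no λ ()
forbidden ≟ₛ forbidden = yes refl
forbidden ≟ₛ free      = no λ ()
free      ≟ₛ required  = no λ ()
free      ≟ₛ forbidden = no λ ()
free      ≟ₛ free      = yes refl

Allowed : Status → Bool → Set
Allowed required b = b ≡ true
Allowed forbidden b = b ≡ false
Allowed free b = ⊤

true≢false : true ≢ false
true≢false ()

allowed? : (t : Status) (b : Bool) → Dec (Allowed t b)
allowed? required b = b BoolP.≟ true
allowed? forbidden b = b BoolP.≟ false
allowed? free b = yes tt

Fits : {n : ℕ} → Vec Status n → Subset n → Set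
Fits pat S = ∀ q → Allowed (lookup pat q) (lookup S q)

occ : {n : ℕ} → Status → Vec Status n → ℕ
occ t pat = Vec.count (_≟ₛ t) pat

FitsWithSize : {n : ℕ} → Vec Status n → ℕ → Subset n → Set
FitsWithSize pat s S = Fits pat S × ∣ S ∣ ≡ occ required pat + s

fitsWithSize? : {n : ℕ} (pat : Vec Status n) (s : ℕ) → Decidable (FitsWithSize pat s)
fitsWithSize? pat s S =
  all? (λ q → allowed? (lookup pat q) (lookup S q)) ×-dec (∣ S ∣ ℕP.≟ occ required pat + s)

required≤size : {n : ℕ} (pat : Vec Status n) (S : Subset n) → Fits pat S → occ required pat ≤ ∣ S ∣
required≤size [] [] _ = z≤n
required≤size (required ∷ pat) (b ∷ S) fits with refl ← fits Fin.zero =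
  s≤s (required≤size pat S (fits ∘ Fin.suc))
required≤size (forbidden ∷ pat) (b ∷ S) fits =
  ℕP.≤-trans (required≤size pat S (fits ∘ Fin.suc)) (∣p∣≤∣x∷p∣ b S)
required≤size (free ∷ pat) (b ∷ S) fits =
  ℕP.≤-trans (required≤size pat S (fits ∘ Fin.suc)) (∣p∣≤∣x∷p∣ b S)

occ-partition : {n : ℕ} (pat : Vec Status n) → occ required pat + (occ forbidden pat + occ free pat) ≡ n
occ-partition [] = refl
occ-partition (required ∷ pat) = cong suc (occ-partition pat)
occ-partition (forbidden ∷ pat) = trans (ℕP.+-suc _ _) (cong suc (occ-partition pat))
occ-partition (free ∷ pat) =
  trans (cong (occ required pat +_) (ℕP.+-suc _ _)) (trans (ℕP.+-suc _ _) (cong suc (occ-partition pat)))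

#-allSubsets-suc : {n : ℕ} {P : Subset (suc n) → Set} (P? : Decidable P) →
  #⟨ P? ⟩ (allSubsets (suc n))
  ≡ #⟨ P? ∘ (true ∷_) ⟩ (allSubsets n) + #⟨ P? ∘ (false ∷_) ⟩ (allSubsets n)
#-allSubsets-suc {n} P? = trans (#-++ P? (map (true ∷_) (allSubsets n)) _)
  (cong₂ _+_ (#-map P? (true ∷_) (allSubsets n)) (#-map P? (false ∷_) (allSubsets n)))

-- The subsets fitting a pattern with s extra elements correspond to the
-- s-subsets of the free positions.
#fitting : {n : ℕ} (pat : Vec Status n) (s : ℕ) →
           #⟨ fitsWithSize? pat s ⟩ (allSubsets n) ≡ binom (occ free pat) s
#fitting [] zero = refl
#fitting [] (suc s) = refl
#fitting {suc n} (t ∷ pat) s = trans (#-allSubsets-suc (fitsWithSize? (t ∷ pat) s)) (by-head t s)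
  where
  A : List (Subset n)
  A = allSubsets n
  r : ℕ
  r = occ required pat

  drop-false : ∀ {t s S} → Allowed t false → occ required (t ∷ pat) ≡ r →
               FitsWithSize (t ∷ pat) s (false ∷ S) ⇔ FitsWithSize pat s S
  drop-false {s = s} ok eq = mk⇔ (λ (fits , e) → fits ∘ Fin.suc , trans e (cong (_+ s) eq))
                                 (λ (fits , e) → FinP.∀-cons ok fits , trans e (cong (_+ s) (sym eq)))

  #drop-false : ∀ {t} s → Allowed t false → occ required (t ∷ pat) ≡ r →
                #⟨ fitsWithSize? (t ∷ pat) s ∘ (false ∷_) ⟩ A ≡ binom (occ free pat) s
  #drop-false s ok eq = trans (#-cong _ _ (λ _ → drop-false ok eq) A) (#fitting pat s)

  required-true : ∀ {s S} → FitsWithSize (required ∷ pat) s (true ∷ S) ⇔ FitsWithSize pat s S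
  required-true = mk⇔ (λ (fits , e) → fits ∘ Fin.suc , ℕP.suc-injective e)
                      (λ (fits , e) → FinP.∀-cons refl fits , cong suc e)

  free-true : ∀ {s S} → FitsWithSize (free ∷ pat) (suc s) (true ∷ S) ⇔ FitsWithSize pat s S
  free-true {s} = mk⇔ (λ (fits , e) → fits ∘ Fin.suc , ℕP.suc-injective (trans e (ℕP.+-suc r s)))
                      (λ (fits , e) → FinP.∀-cons tt fits , trans (cong suc e) (sym (ℕP.+-suc r s)))

  ¬free-true : ∀ {S} → ¬ FitsWithSize (free ∷ pat) 0 (true ∷ S)
  ¬free-true {S} (fits , e) = ℕP.<-irrefl refl
    (subst (_≤ ∣ S ∣) (sym (trans e (ℕP.+-identityʳ r))) (required≤size pat S (fits ∘ Fin.suc)))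

  -- Case analysis on the status of the first position and on whether S
  -- contains it; Pascal's rule appears for a free first position.
  by-head : ∀ t s → #⟨ fitsWithSize? (t ∷ pat) s ∘ (true ∷_) ⟩ A
                    + #⟨ fitsWithSize? (t ∷ pat) s ∘ (false ∷_) ⟩ A
                    ≡ binom (occ free (t ∷ pat)) s
  by-head required s = trans
    (cong₂ _+_ (trans (#-cong _ _ (λ _ → required-true) A) (#fitting pat s))
               (#-none _ (λ _ (fits , _) → true≢false (sym (fits Fin.zero))) A))
    (ℕP.+-identityʳ _)
  by-head forbidden s =
    cong₂ _+_ (#-none _ (λ _ (fits , _) → true≢false (fits Fin.zero)) A) (#drop-false s refl refl)
  by-head free zero = cong₂ _+_ (#-none _ (λ _ → ¬free-true) A) (#drop-false 0 tt refl)
  by-head free (suc s) = trans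
    (cong₂ _+_ (trans (#-cong _ _ (λ _ → free-true) A) (#fitting pat s)) (#drop-false (suc s) tt refl))
    (nCk+nC[k+1]≡[n+1]C[k+1] (occ free pat) s)

classify : {A B : Set} → Dec A → Dec B → Status
classify (yes _) _ = required
classify (no _) (yes _) = forbidden
classify (no _) (no _) = free

module _ {A B : Set} where

  classify-required : (a : Dec A) (b : Dec B) → (classify a b ≡ required) ⇔ A
  classify-required (yes x) _ = mk⇔ (λ _ → x) (λ _ → refl)
  classify-required (no ¬x) (yes _) = mk⇔ (λ ()) (⊥-elim ∘ ¬x)
  classify-required (no ¬x) (no _) = mk⇔ (λ ()) (⊥-elim ∘ ¬x)

  classify-forbidden : (a : Dec A) (b : Dec B) → (classify a b ≡ forbidden) ⇔ (¬ A × B)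
  classify-forbidden (yes x) _ = mk⇔ (λ ()) (λ (¬x , _) → ⊥-elim (¬x x))
  classify-forbidden (no ¬x) (yes y) = mk⇔ (λ _ → ¬x , y) (λ _ → refl)
  classify-forbidden (no _) (no ¬y) = mk⇔ (λ ()) (λ (_ , y) → ⊥-elim (¬y y))

  classify-allowed : (a : Dec A) (b : Dec B) (bit : Bool) →
    Allowed (classify a b) bit ⇔ ((A → bit ≡ true) × (¬ A → B → bit ≡ false))
  classify-allowed (yes x) _ bit =
    mk⇔ (λ set → (λ _ → set) , (λ ¬x _ → ⊥-elim (¬x x))) (λ (set , _) → set x)
  classify-allowed (no ¬x) (yes y) bit =
    mk⇔ (λ unset → (λ x → ⊥-elim (¬x x)) , (λ _ _ → unset)) (λ (_ , unset) → unset ¬x y)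
  classify-allowed (no ¬x) (no ¬y) bit =
    mk⇔ (λ _ → (λ x → ⊥-elim (¬x x)) , (λ _ y → ⊥-elim (¬y y))) (λ _ → tt)

fits-tabulate : {n : ℕ} (f : Fin n → Status) (S : Subset n) →
                Fits (tabulate f) S ⇔ (∀ q → Allowed (f q) (lookup S q))
fits-tabulate f S = mk⇔
  (λ fits q → subst (λ t → Allowed t (lookup S q)) (VecP.lookup∘tabulate f q) (fits q))
  (λ fits q → subst (λ t → Allowed t (lookup S q)) (sym (VecP.lookup∘tabulate f q)) (fits q))

-- Step i of the parking process with outcome π: car i parks at p = π⁻¹ᵢ.
module ParkingStep {n : ℕ} (π : Permutation′ n) (i : Fin n) where

  p : Fin n
  p = π ⟨$⟩ˡ i

  removed⇔ : ∀ q → Removed π i q ⇔ (π ⟨$⟩ʳ q) < i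
  removed⇔ q = mk⇔
    (λ (i' , i'<i , eq) → subst (_< i) (sym (trans (cong (π ⟨$⟩ʳ_) (sym eq)) (inverseʳ π))) i'<i)
    (λ πq<i → π ⟨$⟩ʳ q , πq<i , inverseˡ π)

  outcome-available : ¬ Removed π i p
  outcome-available taken = FinP.<-irrefl (inverseʳ π) (to (removed⇔ p) taken)

  EarlierAvailable : Fin n → Set
  EarlierAvailable q = q < p × ¬ Removed π i q

  earlierAvailable? : Decidable EarlierAvailable
  earlierAvailable? q = (q <? p) ×-dec ¬? (removed? π i q)

  status : Fin n → Status
  status q = classify (q ≟ p) (earlierAvailable? q)

  stepPattern : Vec Status n
  stepPattern = tabulate status

  smallest⇔fits : ∀ S → IsSmallest π i S p ⇔ Fits stepPattern S
  smallest⇔fits S = ⇔.trans (mk⇔ ⇒constraints constraints⇒) (⇔.sym (fits-tabulate status S))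
    where
    allowed : ∀ q → Allowed (status q) (lookup S q) ⇔
                ((q ≡ p → lookup S q ≡ true) × (¬ q ≡ p → EarlierAvailable q → lookup S q ≡ false))
    allowed q = classify-allowed (q ≟ p) (earlierAvailable? q) (lookup S q)

    ⇒constraints : IsSmallest π i S p → ∀ q → Allowed (status q) (lookup S q)
    ⇒constraints ((p∈S , _) , least) q = from (allowed q)
      ( (λ { refl → VecP.[]=⇒lookup p∈S })
      , (λ _ (q<p , avail) → BoolP.¬-not λ q∈S →
           ℕP.<⇒≱ q<p (least q (VecP.lookup⇒[]= q S q∈S , avail))) )

    constraints⇒ : (∀ q → Allowed (status q) (lookup S q)) → IsSmallest π i S p
    constraints⇒ c = (p∈S , outcome-available) , least
      where
      p∈S : p ∈ S
      p∈S = VecP.lookup⇒[]= p S (proj₁ (to (allowed p) (c p)) refl)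
      least : ∀ q → InDiff π i S q → p Fin.≤ q
      least q (q∈S , avail) = ℕP.≮⇒≥ λ q<p → true≢false (trans (sym (VecP.[]=⇒lookup q∈S))
        (proj₂ (to (allowed q) (c q)) (λ q≡p → FinP.<-irrefl q≡p q<p) (q<p , avail)))

  occ-required : occ required stepPattern ≡ 1
  occ-required = begin
    occ required stepPattern                ≡⟨ count-tabulate (_≟ₛ required) status ⟩
    ∑[ q < n ] ind (status q ≟ₛ required)   ≡⟨ sum-cong-≗ required-at ⟩
    ∑[ q < n ] ind (q ≟ p)                  ≡⟨ one-hot p ⟩
    1                                       ∎
    where
    required-at : ∀ q → ind (status q ≟ₛ required) ≡ ind (q ≟ p)
    required-at q = ind-cong (status q ≟ₛ required) (q ≟ p)
                             (classify-required (q ≟ p) (earlierAvailable? q))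

  forbidden⇔ : ∀ q → (¬ q ≡ p × EarlierAvailable q) ⇔ (q < p × i < π ⟨$⟩ʳ q)
  forbidden⇔ q = mk⇔
    (λ (q≢p , q<p , avail) → q<p , FinP.≤∧≢⇒< (ℕP.≮⇒≥ (avail ∘ from (removed⇔ q)))
      (λ i≡πq → q≢p (trans (sym (inverseˡ π)) (cong (π ⟨$⟩ˡ_) (sym i≡πq)))))
    (λ (q<p , i<πq) → (λ q≡p → FinP.<-irrefl q≡p q<p) , q<p ,
      (λ taken → FinP.<-asym (to (removed⇔ q) taken) i<πq))

  occ-forbidden : occ forbidden stepPattern ≡ inv π i
  occ-forbidden = begin
    occ forbidden stepPattern                ≡⟨ count-tabulate (_≟ₛ forbidden) status ⟩
    ∑[ q < n ] ind (status q ≟ₛ forbidden)   ≡⟨ sum-cong-≗ forbidden-at ⟩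
    ∑[ q < n ] ind (inverted? q)             ≡⟨ sym (count-tabulate inverted? (λ q → q)) ⟩
    inv π i                                  ∎
    where
    inverted? : ∀ q → Dec (q < p × i < π ⟨$⟩ʳ q)
    inverted? q = (q <? p) ×-dec (i <? π ⟨$⟩ʳ q)
    forbidden-at : ∀ q → ind (status q ≟ₛ forbidden) ≡ ind (inverted? q)
    forbidden-at q = ind-cong (status q ≟ₛ forbidden) (inverted? q)
      (⇔.trans (classify-forbidden (q ≟ p) (earlierAvailable? q)) (forbidden⇔ q))

  occ-free : occ free stepPattern ≡ n ∸ inv π i ∸ 1
  occ-free = solve (inv π i) (occ free stepPattern)
    (subst₂ (λ r f → r + (f + occ free stepPattern) ≡ n) occ-required occ-forbidden
      (occ-partition stepPattern))
    where
    solve : ∀ a b {m} → 1 + (a + b) ≡ m → b ≡ m ∸ a ∸ 1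
    solve a b refl =
      sym (cong (_∸ 1) (trans (cong (_∸ a) (sym (ℕP.+-suc a b))) (ℕP.m+n∸m≡n a (suc b))))

  Admissible : Subset n → Subset n → Set
  Admissible Li S = IsSmallest π i S p × SizeIn Li ∣ S ∣

  admissible? : (Li : Subset n) → Decidable (Admissible Li)
  admissible? Li S = isSmallest? π i S p ×-dec sizeIn? Li ∣ S ∣

  -- The number of admissible Cᵢ: split by the (mutually exclusive) sizes
  -- ℓ = k + 1 ∈ Lᵢ, each contributing binom(#free, k) by `#fitting`.
  #admissible : (Li : Subset n) → #⟨ admissible? Li ⟩ (allSubsets n) ≡ sumOver Li (n ∸ inv π i ∸ 1)
  #admissible Li = begin
    #⟨ admissible? Li ⟩ (allSubsets n)     ≡⟨ #-cong _ ∃? admissible⇔ (allSubsets n) ⟩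
    #⟨ ∃? ⟩ (allSubsets n)                 ≡⟨ #-∃ Q? ∃? unique (allSubsets n) ⟩
    ∑[ k < n ] #⟨ Q? k ⟩ (allSubsets n)
      ≡⟨ sum-cong-≗ (λ k → #-const× (k ∈? Li) (fitsWithSize? stepPattern (toℕ k)) (allSubsets n)) ⟩
    ∑[ k < n ] (ind (k ∈? Li) * #⟨ fitsWithSize? stepPattern (toℕ k) ⟩ (allSubsets n))
      ≡⟨ sum-cong-≗ (λ k → trans (cong (ind (k ∈? Li) *_) (#fitting stepPattern (toℕ k)))
                                 (ind-* (k ∈? Li) _)) ⟩
    ∑[ k < n ] term k                      ≡⟨ sym (foldr-allFin _+_ 0 term) ⟩
    sumOver Li (occ free stepPattern)      ≡⟨ cong (sumOver Li) occ-free ⟩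
    sumOver Li (n ∸ inv π i ∸ 1)           ∎
    where
    Q : Fin n → Subset n → Set
    Q k S = (k ∈ Li) × FitsWithSize stepPattern (toℕ k) S

    Q? : ∀ k → Decidable (Q k)
    Q? k S = (k ∈? Li) ×-dec fitsWithSize? stepPattern (toℕ k) S

    ∃? : Decidable (λ S → ∃ λ k → Q k S)
    ∃? S = any? (λ k → Q? k S)

    term : Fin n → ℕ
    term k = if does (k ∈? Li) then binom (occ free stepPattern) (toℕ k) else 0

    admissible⇔ : ∀ S → Admissible Li S ⇔ (∃ λ k → Q k S)
    admissible⇔ S = mk⇔
      (λ (least , k , k∈Li , size) → k , k∈Li , to (smallest⇔fits S) least ,
        trans (sym size) (cong (_+ toℕ k) (sym occ-required)))
      (λ (k , k∈Li , fits , size) → from (smallest⇔fits S) fits , k , k∈Li ,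
        sym (trans size (cong (_+ toℕ k) occ-required)))

    -- A set has only one size.
    unique : ∀ S {k l} → Q k S → Q l S → k ≡ l
    unique S (_ , _ , sizeₖ) (_ , _ , sizeₗ) =
      FinP.toℕ-injective (ℕP.+-cancelˡ-≡ (occ required stepPattern) _ _ (trans (sym sizeₖ) sizeₗ))

-- The conditions on an 𝓛-parking function with outcome π are exactly the
-- admissibility of each Cᵢ at step i; nonemptiness is implied since π⁻¹ᵢ ∈ Cᵢ.
lpf⇔admissible : {n : ℕ} (π : Permutation′ n) (L : Fin n → Subset n) (C : Fin n → Subset n) →
                 IsLPF L π C ⇔ (∀ i → ParkingStep.Admissible π i (L i) (C i))
lpf⇔admissible π L C = mk⇔
  (λ ((_ , least) , sizes) i → least i , sizes i)
  (λ adm → ((λ i → π ⟨$⟩ˡ i , proj₁ (proj₁ (proj₁ (adm i)))) , proj₁ ∘ adm) , proj₂ ∘ adm)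

theorem2p4 : (n : ℕ) → 1 ≤ n → (π : Permutation′ n) → (L : Fin n → Subset n) →
    SP n L π ≡ RHS n L π
theorem2p4 n _ π L = begin
  SP n L π
    ≡⟨ #-cong _ admissibleTuple? (lpf⇔admissible π L ∘ lookup) tuples ⟩
  #⟨ admissibleTuple? ⟩ tuples
    ≡⟨ #-tuples (λ i → admissible? i (L i)) (allSubsets n) ⟩
  ∏ (λ i → #⟨ admissible? i (L i) ⟩ (allSubsets n))
    ≡⟨ ∏-cong (λ i → #admissible i (L i)) ⟩
  ∏ (λ i → sumOver (L i) (n ∸ inv π i ∸ 1))
    ≡⟨ sym (foldr-allFin _*_ 1 (λ i → sumOver (L i) (n ∸ inv π i ∸ 1))) ⟩
  RHS n L π ∎
  where
  open ParkingStep π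
  tuples : List (Vec (Subset n) n)
  tuples = allTuples (allSubsets n) n
  admissibleTuple? : Decidable (λ C → ∀ i → Admissible i (L i) (lookup C i))
  admissibleTuple? C = all? (λ i → admissible? i (L i) (lookup C i))
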